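{- There exists an algorithm that computes, for a given constant $\sharp\mathsf{PP}$-formula $\phi$, a logically equivalent $\sharp\mathsf{PP}$-formula $\phi'=EV_1\,PV_2\,n$ with $n\in\mathbb{Z}$ and $V_1,V_2$ finite sets of variables, such that $\mathsf{width}(\phi')\le\mathsf{width}(\phi)$.
   Context: $\sharp$-formulas (over a relational signature): inductively, with free and closed variable sets: $C(\phi,L)$ ($\phi$ first-order, $L\supseteq\mathrm{free}(\phi)$; free $L$, closed $\emptyset$); $PV\psi$ ($V\cap\mathrm{closed}(\psi)=\emptyset$; free $\mathrm{free}(\psi)\setminus V$, closed $V\cup\mathrm{closed}(\psi)$); $EV\psi$ ($V$ disjoint from free and closed variables of $\psi$; free $V\cup\mathrm{free}(\psi)$, closed $\mathrm{closed}(\psi)$); $\psi\times\psi'$ (equal free sets, disjoint closed sets; closed the union); $\psi+\psi'$ (equal free sets; closed the union); $n\in\mathbb{Z}$ (no free or closed variables). Semantics for a finite structure $\mathbf{B}$ and $h:\mathrm{free}\to B$: $[\mathbf{B},C(\phi,L)](h)=1$ if $\mathbf{B},h\models\phi$, else $0$; $[\mathbf{B},PV\psi](h)=\sum[\mathbf{B},\psi](h')$ over extensions $h'$ of $h$ to $\mathrm{free}(\psi)\cup V$; $[\mathbf{B},EV\psi](h)=[\mathbf{B},\psi](h|_{\mathrm{free}(\psi)})$; $\times,+$ pointwise; $[\mathbf{B},n](h)=n$. Logical equivalence: same free variables and equal $[\mathbf{B},\cdot]$ for every structure. $\mathsf{width}$ = max of $|\mathrm{free}(\theta)|$ over $\sharp$-subformulas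 (subtrees) and fo-subformulas. A $\sharp\mathsf{PP}$-formula is one in which every $C(\phi,L)$ has $\phi$ a pp-formula; it is constant if it is built only from integer constants, $\times$, and $P$- and $E$-quantifiers. -}

module Defs where

open import Data.Nat as ℕ using (ℕ; _≟_; _⊔_)
open import Data.Integer as ℤ using (ℤ; +_)
open import Data.Fin as Fin using (Fin)
open import Data.Bool using (Bool; true; false; if_then_else_)
open import Data.List as List using (List; []; _∷_; _++_; filter; length; deduplicate; map; foldr; allFin)
open import Data.Bool.ListAction using (any)
open import Data.List.Membership.Propositional using (_∈_; _∉_)
open import Data.List.Membership.DecPropositional _≟_ using (_∈?_)
open import Data.Maybe using (Maybe; just; nothing; Is-just)
open import Data.Vec as Vec using (Vec)
open import Data.Product using (_×_; _,_)
open import Data.Unit using (⊤)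
open import Data.Empty using (⊥)
open import Relation.Nullary using (¬_; ¬?)
open import Relation.Nullary.Decidable using (⌊_⌋)
open import Relation.Binary.PropositionalEquality using (_≡_)

record Signature : Set₁ where
  field
    Sym   : Set
    arity : Sym → ℕ
open Signature public

-- Variables are natural numbers; finite sets of variables are lists
-- (read as sets: only membership matters, duplicates are ignored).
Var : Set
Var = ℕ

VarSet : Set
VarSet = List Var

_⊆ᵛ_ : VarSet → VarSet → Set
A ⊆ᵛ B = ∀ x → x ∈ A → x ∈ B

SameSet : VarSet → VarSet → Set
SameSet A B = A ⊆ᵛ B × B ⊆ᵛ A

Disjoint : VarSet → VarSet → Set
Disjoint A B = ∀ x → x ∈ A → x ∈ B → ⊥

_∖_ : VarSet → VarSet → VarSet
A ∖ B = filter (λ x → ¬? (x ∈? B)) A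

card : VarSet → ℕ
card A = length (deduplicate _≟_ A)

maxList : List ℕ → ℕ
maxList = foldr _⊔_ 0

module _ (S : Signature) where

  data FO : Set where
    atom : (R : Sym S) → Vec Var (arity S R) → FO
    eqᶠ  : Var → Var → FO
    ⊤ᶠ ⊥ᶠ : FO
    _∧ᶠ_ _∨ᶠ_ : FO → FO → FO
    ¬ᶠ_  : FO → FO
    ∃ᶠ ∀ᶠ : Var → FO → FO

  freeFO : FO → VarSet
  freeFO (atom R xs) = Vec.toList xs
  freeFO (eqᶠ x y) = x ∷ y ∷ []
  freeFO ⊤ᶠ = []
  freeFO ⊥ᶠ = []
  freeFO (φ ∧ᶠ ψ) = freeFO φ ++ freeFO ψ
  freeFO (φ ∨ᶠ ψ) = freeFO φ ++ freeFO ψ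
  freeFO (¬ᶠ φ) = freeFO φ
  freeFO (∃ᶠ x φ) = freeFO φ ∖ (x ∷ [])
  freeFO (∀ᶠ x φ) = freeFO φ ∖ (x ∷ [])

  subFO : FO → List FO
  subFO φ@(atom _ _) = φ ∷ []
  subFO φ@(eqᶠ _ _) = φ ∷ []
  subFO ⊤ᶠ = ⊤ᶠ ∷ []
  subFO ⊥ᶠ = ⊥ᶠ ∷ []
  subFO φ@(ψ ∧ᶠ χ) = φ ∷ subFO ψ ++ subFO χ
  subFO φ@(ψ ∨ᶠ χ) = φ ∷ subFO ψ ++ subFO χ
  subFO φ@(¬ᶠ ψ) = φ ∷ subFO ψ
  subFO φ@(∃ᶠ _ ψ) = φ ∷ subFO ψ
  subFO φ@(∀ᶠ _ ψ) = φ ∷ subFO ψ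

  IsPP : FO → Set
  IsPP (atom _ _) = ⊤
  IsPP (eqᶠ _ _) = ⊤
  IsPP ⊤ᶠ = ⊤
  IsPP ⊥ᶠ = ⊥
  IsPP (φ ∧ᶠ ψ) = IsPP φ × IsPP ψ
  IsPP (_ ∨ᶠ _) = ⊥
  IsPP (¬ᶠ _) = ⊥
  IsPP (∃ᶠ _ φ) = IsPP φ
  IsPP (∀ᶠ _ _) = ⊥

  data SF : Set where
    C     : FO → VarSet → SF
    P     : VarSet → SF → SF
    E     : VarSet → SF → SF
    _⊗_   : SF → SF → SF
    _⊕_   : SF → SF → SF
    const : ℤ → SF

  free : SF → VarSet
  free (C φ L) = L
  free (P V ψ) = free ψ ∖ V
  free (E V ψ) = V ++ free ψ
  free (ψ ⊗ ψ') = free ψ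
  free (ψ ⊕ ψ') = free ψ
  free (const n) = []

  closed : SF → VarSet
  closed (C φ L) = []
  closed (P V ψ) = V ++ closed ψ
  closed (E V ψ) = closed ψ
  closed (ψ ⊗ ψ') = closed ψ ++ closed ψ'
  closed (ψ ⊕ ψ') = closed ψ ++ closed ψ'
  closed (const n) = []

  WF : SF → Set
  WF (C φ L) = freeFO φ ⊆ᵛ L
  WF (P V ψ) = WF ψ × Disjoint V (closed ψ)
  WF (E V ψ) = WF ψ × Disjoint V (free ψ) × Disjoint V (closed ψ)
  WF (ψ ⊗ ψ') = WF ψ × WF ψ' × SameSet (free ψ) (free ψ') × Disjoint (closed ψ) (closed ψ')
  WF (ψ ⊕ ψ') = WF ψ × WF ψ' × SameSet (free ψ) (free ψ')
  WF (const n) = ⊤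

  IsSharpPP : SF → Set
  IsSharpPP (C φ L) = IsPP φ
  IsSharpPP (P V ψ) = IsSharpPP ψ
  IsSharpPP (E V ψ) = IsSharpPP ψ
  IsSharpPP (ψ ⊗ ψ') = IsSharpPP ψ × IsSharpPP ψ'
  IsSharpPP (ψ ⊕ ψ') = IsSharpPP ψ × IsSharpPP ψ'
  IsSharpPP (const n) = ⊤

  IsConstant : SF → Set
  IsConstant (C φ L) = ⊥
  IsConstant (P V ψ) = IsConstant ψ
  IsConstant (E V ψ) = IsConstant ψ
  IsConstant (ψ ⊗ ψ') = IsConstant ψ × IsConstant ψ'
  IsConstant (ψ ⊕ ψ') = ⊥
  IsConstant (const n) = ⊤

  width : SF → ℕ
  width (C φ L) = card L ⊔ maxList (map (λ χ → card (freeFO χ)) (subFO φ))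
  width θ@(P V ψ) = card (free θ) ⊔ width ψ
  width θ@(E V ψ) = card (free θ) ⊔ width ψ
  width θ@(ψ ⊗ ψ') = card (free θ) ⊔ width ψ ⊔ width ψ'
  width θ@(ψ ⊕ ψ') = card (free θ) ⊔ width ψ ⊔ width ψ'
  width (const n) = 0

  record Structure : Set where
    field
      size : ℕ
      rel  : (R : Sym S) → Vec (Fin size) (arity S R) → Bool
  open Structure public

  Assignment : ℕ → Set
  Assignment m = Var → Maybe (Fin m)

  HasDomain : ∀ {m} → Assignment m → VarSet → Set
  HasDomain h L = ∀ x → (x ∈ L → Is-just (h x)) × (x ∉ L → h x ≡ nothing)

  update : ∀ {m} → Assignment m → Var → Fin m → Assignment m
  update h x b y = if ⌊ y ≟ x ⌋ then just b else h y

  restrict : ∀ {m} → VarSet → Assignment m → Assignment m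
  restrict L h y = if ⌊ y ∈? L ⌋ then h y else nothing

  lookupAll : ∀ {m k} → Assignment m → Vec Var k → Maybe (Vec (Fin m) k)
  lookupAll h Vec.[] = just Vec.[]
  lookupAll h (x Vec.∷ xs) with h x | lookupAll h xs
  ... | just b | just bs = just (b Vec.∷ bs)
  ... | _ | _ = nothing

  evalFO : (A : Structure) → FO → Assignment (size A) → Bool
  evalFO A (atom R xs) h with lookupAll h xs
  ... | just bs = rel A R bs
  ... | nothing = false
  evalFO A (eqᶠ x y) h with h x | h y
  ... | just a | just b = ⌊ a Fin.≟ b ⌋
  ... | _ | _ = false
  evalFO A ⊤ᶠ h = true
  evalFO A ⊥ᶠ h = false
  evalFO A (φ ∧ᶠ ψ) h = if evalFO A φ h then evalFO A ψ h else false
  evalFO A (φ ∨ᶠ ψ) h = if evalFO A φ h then true else evalFO A ψ h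
  evalFO A (¬ᶠ φ) h = if evalFO A φ h then false else true
  evalFO A (∃ᶠ x φ) h = any (λ b → evalFO A φ (update h x b)) (allFin (size A))
  evalFO A (∀ᶠ x φ) h =
    if any (λ b → if evalFO A φ (update h x b) then false else true) (allFin (size A))
    then false else true

  sumℤ : List ℤ → ℤ
  sumℤ = foldr ℤ._+_ (+ 0)

  -- sum of f over all extensions of h to the (distinct) variables in the list
  sumOver : ∀ {m} → List Var → Assignment m → (Assignment m → ℤ) → ℤ
  sumOver [] h f = f h
  sumOver {m} (x ∷ xs) h f = sumℤ (map (λ b → sumOver xs (update h x b) f) (allFin m))

  ⟦_,_⟧ : (A : Structure) → SF → Assignment (size A) → ℤ
  ⟦ A , C φ L ⟧ h = if evalFO A φ h then + 1 else + 0
  ⟦ A , P V ψ ⟧ h = sumOver (deduplicate _≟_ V) h ⟦ A , ψ ⟧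
  ⟦ A , E V ψ ⟧ h = ⟦ A , ψ ⟧ (restrict (free ψ) h)
  ⟦ A , ψ ⊗ ψ' ⟧ h = ⟦ A , ψ ⟧ h ℤ.* ⟦ A , ψ' ⟧ h
  ⟦ A , ψ ⊕ ψ' ⟧ h = ⟦ A , ψ ⟧ h ℤ.+ ⟦ A , ψ' ⟧ h
  ⟦ A , const n ⟧ h = n

  LogEquiv : SF → SF → Set
  LogEquiv φ ψ = SameSet (free φ) (free ψ) ×
    (∀ (A : Structure) (h : Assignment (size A)) → HasDomain h (free φ) →
       ⟦ A , φ ⟧ h ≡ ⟦ A , ψ ⟧ h)

-- A constant ♯PP-formula φ denotes a constant function, namely N · |B|^K on a
-- structure with universe B, where N is the product of the integer constants
-- of φ and K the number of variables bound by its P-quantifiers.  This value is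
-- also denoted by E free(φ) (P V (const N)) for any K distinct variables V
-- outside free(φ), and the width of that formula is |free(φ)| ≤ width(φ).
module Submission where

open import Defs
open import Data.Nat using (ℕ; _≤_)
open import Data.Integer using (ℤ)
open import Data.List using (List)
open import Data.Product using (Σ; _×_; _,_; Σ-syntax)

open import Data.Nat as ℕ using (zero; suc; _<_; _⊔_; _^_; z≤n)
import Data.Nat.Properties as ℕ
open import Data.Integer as ℤ using (+_)
import Data.Integer.Properties as ℤ
open import Data.List using ([]; _∷_; _++_; length; deduplicate; map; allFin; applyDownFrom)
open import Data.List.Properties using (filter-all; ++-identityʳ; length-tabulate; length-applyDownFrom)
import Data.List.Relation.Unary.All as All
open import Data.List.Relation.Unary.Any using (here; there)
open import Data.List.Membership.Propositional using (_∈_)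
open import Data.Product using (∃-syntax)
open import Data.Unit using (tt)
open import Relation.Nullary using (¬?)
open import Relation.Binary.PropositionalEquality
open import Function using (_∘_)
open import Function.Definitions using (Injective)
open import Algebra.Properties.CommutativeSemigroup ℤ.*-commutativeSemigroup using (interchange)

≤-maxList : ∀ {x} xs → x ∈ xs → x ≤ maxList xs
≤-maxList (y ∷ ys) (here refl) = ℕ.m≤m⊔n y (maxList ys)
≤-maxList (y ∷ ys) (there x∈ys) = ℕ.≤-trans (≤-maxList ys x∈ys) (ℕ.m≤n⊔m y (maxList ys))

∈-applyDownFrom⁻ : ∀ {A : Set} (f : ℕ → A) n {y} → y ∈ applyDownFrom f n → ∃[ i ] i < n × y ≡ f i
∈-applyDownFrom⁻ f (suc n) (here refl) = n , ℕ.n<1+n n , refl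
∈-applyDownFrom⁻ f (suc n) (there y∈fs) with ∈-applyDownFrom⁻ f n y∈fs
... | i , i<n , refl = i , ℕ.m<n⇒m<1+n i<n , refl

deduplicate-applyDownFrom : ∀ (f : ℕ → ℕ) → Injective _≡_ _≡_ f → ∀ n →
  deduplicate ℕ._≟_ (applyDownFrom f n) ≡ applyDownFrom f n
deduplicate-applyDownFrom f f-injective zero = refl
deduplicate-applyDownFrom f f-injective (suc n)
  rewrite deduplicate-applyDownFrom f f-injective n =
    cong (f n ∷_) (filter-all (¬? ∘ (f n ℕ.≟_)) (All.tabulate fn∉))
  where
  fn∉ : ∀ {y} → y ∈ applyDownFrom f n → f n ≢ y
  fn∉ y∈fs fn≡y with ∈-applyDownFrom⁻ f n y∈fs
  ... | i , i<n , refl = ℕ.<-irrefl (sym (f-injective fn≡y)) i<n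

fresh : VarSet → ℕ → VarSet
fresh V = applyDownFrom (suc (maxList V) ℕ.+_)

fresh-disjoint : ∀ V k → Disjoint V (fresh V k)
fresh-disjoint V k x x∈V x∈fresh with ∈-applyDownFrom⁻ (suc (maxList V) ℕ.+_) k x∈fresh
... | i , _ , refl = ℕ.<-irrefl refl
  (ℕ.≤-trans (ℕ.m≤m+n (suc (maxList V)) i) (≤-maxList V x∈V))

length-deduplicate-fresh : ∀ V k → length (deduplicate ℕ._≟_ (fresh V k)) ≡ k
length-deduplicate-fresh V k = begin
  length (deduplicate ℕ._≟_ (fresh V k))
    ≡⟨ cong length (deduplicate-applyDownFrom _ (ℕ.+-cancelˡ-≡ (suc (maxList V)) _ _) k) ⟩
  length (fresh V k)
    ≡⟨ length-applyDownFrom _ k ⟩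
  k ∎
  where open ≡-Reasoning

⊆-++-[] : ∀ V → V ⊆ᵛ (V ++ [])
⊆-++-[] V = subst (V ⊆ᵛ_) (sym (++-identityʳ V)) (λ _ x∈V → x∈V)

++-[]-⊆ : ∀ V → (V ++ []) ⊆ᵛ V
++-[]-⊆ V = subst (_⊆ᵛ V) (sym (++-identityʳ V)) (λ _ x∈V → x∈V)

pos-^-+ : ∀ m k l → + (m ^ (k ℕ.+ l)) ≡ + (m ^ k) ℤ.* + (m ^ l)
pos-^-+ m k l = trans (cong +_ (ℕ.^-distribˡ-+-* m k l)) (ℤ.pos-* (m ^ k) (m ^ l))

module _ (S : Signature) where

  sumℤ-const : ∀ {A : Set} (g : A → ℤ) c → (∀ x → g x ≡ c) → ∀ xs →
    sumℤ S (map g xs) ≡ + length xs ℤ.* c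
  sumℤ-const g c g≡c [] = refl
  sumℤ-const g c g≡c (x ∷ xs) = begin
    g x ℤ.+ sumℤ S (map g xs)   ≡⟨ cong₂ ℤ._+_ (g≡c x) (sumℤ-const g c g≡c xs) ⟩
    c ℤ.+ + length xs ℤ.* c     ≡⟨ ℤ.suc-* (+ length xs) c ⟨
    + suc (length xs) ℤ.* c     ∎
    where open ≡-Reasoning

  sumOver-const : ∀ {m} (f : Assignment S m → ℤ) c → (∀ h → f h ≡ c) → ∀ xs h →
    sumOver S xs h f ≡ + (m ^ length xs) ℤ.* c
  sumOver-const f c f≡c [] h = trans (f≡c h) (sym (ℤ.*-identityˡ c))
  sumOver-const {m} f c f≡c (x ∷ xs) h = begin
    sumℤ S (map (λ b → sumOver S xs (update S h x b) f) (allFin m))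
      ≡⟨ sumℤ-const _ _ (λ b → sumOver-const f c f≡c xs (update S h x b)) (allFin m) ⟩
    + length (allFin m) ℤ.* (+ (m ^ length xs) ℤ.* c)
      ≡⟨ cong (λ l → + l ℤ.* (+ (m ^ length xs) ℤ.* c)) (length-tabulate {n = m} (λ i → i)) ⟩
    + m ℤ.* (+ (m ^ length xs) ℤ.* c)
      ≡⟨ ℤ.*-assoc (+ m) _ c ⟨
    (+ m ℤ.* + (m ^ length xs)) ℤ.* c
      ≡⟨ cong (ℤ._* c) (ℤ.pos-* m (m ^ length xs)) ⟨
    + (m ^ suc (length xs)) ℤ.* c ∎
    where open ≡-Reasoning

  -- N and K of a constant formula; the remaining cases are junk values.
  scalar : SF S → ℤ
  scalar (P V ψ) = scalar ψ
  scalar (E V ψ) = scalar ψ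
  scalar (ψ ⊗ ψ′) = scalar ψ ℤ.* scalar ψ′
  scalar (const n) = n
  scalar (C φ L) = + 0
  scalar (ψ ⊕ ψ′) = + 0

  degree : SF S → ℕ
  degree (P V ψ) = length (deduplicate ℕ._≟_ V) ℕ.+ degree ψ
  degree (E V ψ) = degree ψ
  degree (ψ ⊗ ψ′) = degree ψ ℕ.+ degree ψ′
  degree (const n) = 0
  degree (C φ L) = 0
  degree (ψ ⊕ ψ′) = 0

  ⟦⟧-constant : ∀ φ → IsConstant S φ → ∀ A h →
    ⟦_,_⟧ S A φ h ≡ + (size A ^ degree φ) ℤ.* scalar φ
  ⟦⟧-constant (P V ψ) c A h = begin
    sumOver S (deduplicate ℕ._≟_ V) h (⟦_,_⟧ S A ψ)
      ≡⟨ sumOver-const _ _ (⟦⟧-constant ψ c A) (deduplicate ℕ._≟_ V) h ⟩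
    + (m ^ k) ℤ.* (+ (m ^ degree ψ) ℤ.* scalar ψ)
      ≡⟨ ℤ.*-assoc (+ (m ^ k)) _ (scalar ψ) ⟨
    (+ (m ^ k) ℤ.* + (m ^ degree ψ)) ℤ.* scalar ψ
      ≡⟨ cong (ℤ._* scalar ψ) (pos-^-+ m k (degree ψ)) ⟨
    + (m ^ (k ℕ.+ degree ψ)) ℤ.* scalar ψ ∎
    where open ≡-Reasoning
          m = size A
          k = length (deduplicate ℕ._≟_ V)
  ⟦⟧-constant (E V ψ) c A h = ⟦⟧-constant ψ c A _
  ⟦⟧-constant (ψ ⊗ ψ′) (c , c′) A h = begin
    ⟦_,_⟧ S A ψ h ℤ.* ⟦_,_⟧ S A ψ′ h
      ≡⟨ cong₂ ℤ._*_ (⟦⟧-constant ψ c A h) (⟦⟧-constant ψ′ c′ A h) ⟩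
    (+ (m ^ degree ψ) ℤ.* scalar ψ) ℤ.* (+ (m ^ degree ψ′) ℤ.* scalar ψ′)
      ≡⟨ interchange (+ (m ^ degree ψ)) (scalar ψ) (+ (m ^ degree ψ′)) (scalar ψ′) ⟩
    (+ (m ^ degree ψ) ℤ.* + (m ^ degree ψ′)) ℤ.* (scalar ψ ℤ.* scalar ψ′)
      ≡⟨ cong (ℤ._* _) (pos-^-+ m (degree ψ) (degree ψ′)) ⟨
    + (m ^ (degree ψ ℕ.+ degree ψ′)) ℤ.* (scalar ψ ℤ.* scalar ψ′) ∎
    where open ≡-Reasoning
          m = size A
  ⟦⟧-constant (const n) c A h = sym (ℤ.*-identityˡ n)

  card-free≤width : ∀ φ → card (free S φ) ≤ width S φ
  card-free≤width (C φ L) = ℕ.m≤m⊔n _ _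
  card-free≤width (P V ψ) = ℕ.m≤m⊔n _ _
  card-free≤width (E V ψ) = ℕ.m≤m⊔n _ _
  card-free≤width (ψ ⊗ ψ′) = ℕ.≤-trans (ℕ.m≤m⊔n _ _) (ℕ.m≤m⊔n _ _)
  card-free≤width (ψ ⊕ ψ′) = ℕ.≤-trans (ℕ.m≤m⊔n _ _) (ℕ.m≤m⊔n _ _)
  card-free≤width (const n) = z≤n

  normalForm : SF S → SF S
  normalForm φ = E (free S φ) (P (fresh (free S φ) (degree φ)) (const (scalar φ)))

  normalForm-wf : ∀ φ → WF S (normalForm φ)
  normalForm-wf φ = (tt , λ _ _ ()) , (λ _ _ ()) , λ x x∈V x∈fresh →
    fresh-disjoint (free S φ) (degree φ) x x∈V (++-[]-⊆ _ x x∈fresh)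

  normalForm-equiv : ∀ φ → IsConstant S φ → LogEquiv S φ (normalForm φ)
  normalForm-equiv φ c = (⊆-++-[] V , ++-[]-⊆ V) , λ A h _ → begin
    ⟦_,_⟧ S A φ h
      ≡⟨ ⟦⟧-constant φ c A h ⟩
    + (size A ^ K) ℤ.* scalar φ
      ≡⟨ cong (λ k → + (size A ^ k) ℤ.* scalar φ) (length-deduplicate-fresh V K) ⟨
    + (size A ^ length Vₖ) ℤ.* scalar φ
      ≡⟨ sumOver-const (λ _ → scalar φ) (scalar φ) (λ _ → refl) Vₖ _ ⟨
    ⟦_,_⟧ S A (normalForm φ) h ∎
    where open ≡-Reasoning
          V = free S φ
          K = degree φ
          Vₖ = deduplicate ℕ._≟_ (fresh V K)

  normalForm-width : ∀ φ → width S (normalForm φ) ≤ width S φ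
  normalForm-width φ = begin
    card (free S φ ++ []) ⊔ 0 ≡⟨ ℕ.⊔-identityʳ _ ⟩
    card (free S φ ++ [])     ≡⟨ cong card (++-identityʳ (free S φ)) ⟩
    card (free S φ)           ≤⟨ card-free≤width φ ⟩
    width S φ                 ∎
    where open ℕ.≤-Reasoning

lemmaC4 : (S : Signature) →
  Σ[ alg ∈ (SF S → List ℕ × List ℕ × ℤ) ]
    (∀ (φ : SF S) → WF S φ → IsSharpPP S φ → IsConstant S φ →
      let (V₁ , V₂ , n) = alg φ
          φ′ = E V₁ (P V₂ (const n))
      in WF S φ′ × IsSharpPP S φ′ × LogEquiv S φ φ′ × width S φ′ ≤ width S φ)
lemmaC4 S =
    (λ φ → free S φ , fresh (free S φ) (degree S φ) , scalar S φ)
  , λ φ _ _ c → normalForm-wf S φ , tt , normalForm-equiv S φ c , normalForm-width S φ
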